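{- Let $G=(\delta,E)$ be a triangle-free graph on an ordinal $\delta$, let $k\geq 1$ be a natural number, and let $A,B\subseteq\delta$ with $\mathrm{otp}(A)=\omega^k$ and $\mathrm{otp}(B)=\omega$ be disjoint and such that $A\Rightarrow B$. Then there exists $b\in B$ such that $\mathrm{otp}(N(b)\cap A)=\omega^k$.
   Context: Graphs are simple with symmetric edge relation. For a vertex $v$, $N(v)=\{u:(v,u)\in E\}$, and for a set $U$ of vertices $N(U)=\bigcup_{v\in U}N(v)$. For infinite disjoint sets $A,B\subseteq\delta$ without maxima: write $A\to B$ if for every cofinal subset $X\subseteq A$ the set $B\setminus N(X)$ is finite; write $A\Rightarrow B$ if $A\to B$ and moreover $N(a)\cap B$ is finite for every $a\in A$. $\mathrm{otp}$ denotes order type. -}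

module Defs where

open import Level using (0ℓ)
open import Data.Nat using (ℕ) renaming (_<_ to _<ℕ_)
open import Data.Vec using (Vec; []; _∷_)
open import Data.List using (List)
open import Data.List.Membership.Propositional using (_∈_)
open import Data.Product using (Σ; ∃; _×_; _,_)
open import Data.Sum using (_⊎_)
open import Data.Empty using (⊥)
open import Relation.Nullary using (¬_)
open import Relation.Binary.PropositionalEquality using (_≡_)
open import Relation.Binary.Structures using (IsStrictTotalOrder)
open import Induction.WellFounded using (WellFounded)

record Ordinal : Set₁ where
  field
    Carrier : Set
    _<_ : Carrier → Carrier → Set
    isStrictTotalOrder : IsStrictTotalOrder _≡_ _<_
    wellFounded : WellFounded _<_

record Graph (V : Set) : Set₁ where
  field
    E : V → V → Set
    sym : ∀ {u v} → E u v → E v u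
    irrefl : ∀ {v} → ¬ E v v

Subset : Set → Set₁
Subset V = V → Set

module _ {V : Set} where

  _∩_ : Subset V → Subset V → Subset V
  (S ∩ T) v = S v × T v

  _⊆_ : Subset V → Subset V → Set
  S ⊆ T = ∀ v → S v → T v

  Disjoint : Subset V → Subset V → Set
  Disjoint S T = ∀ v → S v → T v → ⊥

  Finite : Subset V → Set
  Finite S = Σ (List V) λ l → ∀ v → S v → v ∈ l

  _∖_ : Subset V → Subset V → Subset V
  (S ∖ T) v = S v × ¬ T v

module GraphNotions {V : Set} (G : Graph V) where
  open Graph G

  TriangleFree : Set
  TriangleFree = ∀ x y z → E x y → E y z → E x z → ⊥

  N : V → Subset V
  N v u = E v u

  N[_] : Subset V → Subset V
  N[ U ] u = Σ V λ v → U v × E v u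

-- Strict lexicographic order on Vec ℕ k (first coordinate most significant);
-- (Vec ℕ k , _<lex_) has order type ω^k.
data _<lex_ : ∀ {k} → Vec ℕ k → Vec ℕ k → Set where
  here  : ∀ {k} {x y : ℕ} {xs ys : Vec ℕ k} → x <ℕ y → (x ∷ xs) <lex (y ∷ ys)
  there : ∀ {k} {x : ℕ} {xs ys : Vec ℕ k} → xs <lex ys → (x ∷ xs) <lex (x ∷ ys)

module OrdinalNotions (δ : Ordinal) where
  open Ordinal δ

  _≤_ : Carrier → Carrier → Set
  a ≤ b = a ≡ b ⊎ a < b

  -- otp(S) = ω^k : there is an order isomorphism from (Vec ℕ k, <lex) onto S.
  OtpOmegaPow : ℕ → Subset Carrier → Set
  OtpOmegaPow k S =
    Σ (Vec ℕ k → Carrier) λ f →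
      (∀ x y → x <lex y → f x < f y) ×
      (∀ x → S (f x)) ×
      (∀ v → S v → Σ (Vec ℕ k) λ x → f x ≡ v)

  Cofinal : Subset Carrier → Subset Carrier → Set
  Cofinal A X = X ⊆ A × (∀ a → A a → Σ Carrier λ x → X x × a ≤ x)

  module _ (G : Graph Carrier) where
    open GraphNotions G

    _⟶_ : Subset Carrier → Subset Carrier → Set₁
    A ⟶ B = ∀ X → Cofinal A X → Finite (B ∖ N[ X ])

    _⟹_ : Subset Carrier → Subset Carrier → Set₁
    A ⟹ B = (A ⟶ B) × (∀ a → A a → Finite (N a ∩ B))

module Submission where

-- Enumerate A by α : ω^k → A and B by β : ω → B.  If some N(β n) ∩ A is Large
-- it contains a copy of ω^k and hence has order type ω^k.  Otherwise build
-- β n₀, α x₀, β n₁, α x₁, … with indices tending to infinity and no edge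
-- between the chosen β's and α's: a fresh β n exists because each vertex of A
-- has only finitely many neighbours in B, and a fresh α x exists in every late
-- enough column because finitely many small sets cannot cover ω^k.  The α xᵢ
-- are cofinal in A yet miss all β nᵢ, contradicting A → B.

open import Defs
open import Level using (0ℓ)
open import Axiom.ExcludedMiddle using (ExcludedMiddle)
open import Data.Nat using (ℕ; zero; suc; _≤_; _<_; _≥_; _⊔_; s≤s)
open import Data.Nat.Properties
  using (≤-refl; ≤-reflexive; ≤-trans; <-trans; <-cmp; <⇒≱; m≤m⊔n; m≤n⊔m; m≤n⇒m≤1+n; m≤n⇒m<n∨m≡n)
open import Data.Vec using (Vec; []; _∷_; head)
open import Data.List using (List; []; _∷_; map)
open import Data.List.Membership.Propositional using (_∈_; lose)
open import Data.List.Membership.Propositional.Properties using (∈-map⁺)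
open import Data.List.Relation.Unary.Any using (Any; here; there)
open import Data.Product using (Σ; _×_; _,_; proj₁; proj₂)
open import Data.Sum using (_⊎_; inj₁; inj₂)
open import Data.Unit using (⊤; tt)
open import Data.Empty using (⊥; ⊥-elim)
open import Relation.Nullary using (¬_; yes; no)
open import Relation.Nullary.Decidable using (toSum)
open import Relation.Binary.PropositionalEquality using (_≡_; refl; sym; trans; subst)
open import Relation.Binary.Definitions using (Trichotomous; tri<; tri≈; tri>)
open import Relation.Binary.Structures using (IsStrictTotalOrder)
open import Induction.WellFounded using (WellFounded; Acc; acc; WfRec; module All; module FixPoint; module Subrelation)
import Relation.Binary.Construct.On as On

<lex-trichotomy : ∀ {j} (x y : Vec ℕ j) → x <lex y ⊎ x ≡ y ⊎ y <lex x
<lex-trichotomy [] [] = inj₂ (inj₁ refl)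
<lex-trichotomy (a ∷ xs) (b ∷ ys) with <-cmp a b
... | tri< a<b _ _ = inj₁ (here a<b)
... | tri> _ _ b<a = inj₂ (inj₂ (here b<a))
... | tri≈ _ refl _ with <lex-trichotomy xs ys
...   | inj₁ xs<ys = inj₁ (there xs<ys)
...   | inj₂ (inj₁ refl) = inj₂ (inj₁ refl)
...   | inj₂ (inj₂ ys<xs) = inj₂ (inj₂ (there ys<xs))

<head⇒<lex : ∀ {j c} {ys : Vec ℕ j} x → c < head x → (c ∷ ys) <lex x
<head⇒<lex (_ ∷ _) c<head = here c<head

step-increasing⇒increasing : (c : ℕ → ℕ) → (∀ i → c i < c (suc i)) → ∀ {i i′} → i < i′ → c i < c i′
step-increasing⇒increasing c step {i} {suc i′} (s≤s i≤i′) with m≤n⇒m<n∨m≡n i≤i′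
... | inj₁ i<i′ = <-trans (step-increasing⇒increasing c step i<i′) (step i′)
... | inj₂ refl = step i

-- The combinatorial form of "S ⊆ ω^j has order type ω^j": unboundedly many
-- first coordinates have a large fibre.
Large : (j : ℕ) → (Vec ℕ j → Set) → Set
Large zero S = S []
Large (suc j) S = ∀ m → Σ ℕ λ n → m ≤ n × Large j (λ xs → S (n ∷ xs))

Large-mono : ∀ j {S T : Vec ℕ j → Set} → (∀ x → S x → T x) → Large j S → Large j T
Large-mono zero S⊆T L = S⊆T [] L
Large-mono (suc j) S⊆T L m =
  let (n , m≤n , L′) = L m in n , m≤n , Large-mono j (λ xs → S⊆T (n ∷ xs)) L′

Large-⊤ : ∀ j → Large j (λ _ → ⊤)
Large-⊤ zero = tt
Large-⊤ (suc j) m = m , ≤-refl , Large-⊤ j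

Large⇒nonempty : ∀ j {S : Vec ℕ j → Set} → Large j S → Σ (Vec ℕ j) S
Large⇒nonempty zero L = [] , L
Large⇒nonempty (suc j) L =
  let (n , _ , L′) = L 0 ; (xs , s) = Large⇒nonempty j L′ in n ∷ xs , s

Large⇒unbounded : ∀ j {S : Vec ℕ (suc j) → Set} → Large (suc j) S →
                  ∀ i → Σ (Vec ℕ (suc j)) λ x → i ≤ head x × S x
Large⇒unbounded j L i =
  let (n , i≤n , L′) = L i ; (xs , s) = Large⇒nonempty j L′ in n ∷ xs , i≤n , s

Large⇒embedding : ∀ j {S : Vec ℕ j → Set} → Large j S →
  Σ (Vec ℕ j → Vec ℕ j) λ e → (∀ x y → x <lex y → e x <lex e y) × (∀ x → S (e x))
Large⇒embedding zero L = (λ _ → []) , (λ { _ _ () }) , (λ { [] → L })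
Large⇒embedding (suc j) {S} L = e , e-mono , e∈S
  where
  column : ℕ → Σ ℕ λ n → Large j (λ xs → S (n ∷ xs))
  column zero = let (n , _ , L′) = L 0 in n , L′
  column (suc i) = let (n , _ , L′) = L (suc (proj₁ (column i))) in n , L′
  c : ℕ → ℕ
  c i = proj₁ (column i)
  c-step : ∀ i → c i < c (suc i)
  c-step i = proj₁ (proj₂ (L (suc (c i))))
  fibre : ∀ i → Σ (Vec ℕ j → Vec ℕ j) λ e → (∀ x y → x <lex y → e x <lex e y) × (∀ x → S (c i ∷ e x))
  fibre i = Large⇒embedding j (proj₂ (column i))
  e : Vec ℕ (suc j) → Vec ℕ (suc j)
  e (i ∷ xs) = c i ∷ proj₁ (fibre i) xs
  e-mono : ∀ x y → x <lex y → e x <lex e y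
  e-mono (i ∷ xs) (i′ ∷ ys) (here i<i′) = here (step-increasing⇒increasing c c-step i<i′)
  e-mono (i ∷ xs) (.i ∷ ys) (there xs<ys) = there (proj₁ (proj₂ (fibre i)) xs ys xs<ys)
  e∈S : ∀ x → S (e x)
  e∈S (i ∷ xs) = proj₂ (proj₂ (fibre i)) xs

module _ (em : ExcludedMiddle 0ℓ) where

  ¬Large⇒small-fibres : ∀ j {S : Vec ℕ (suc j) → Set} → ¬ Large (suc j) S →
    Σ ℕ λ m → ∀ n → m ≤ n → ¬ Large j (λ xs → S (n ∷ xs))
  ¬Large⇒small-fibres j {S} ¬L with em {Σ ℕ λ m → ∀ n → m ≤ n → ¬ Large j (λ xs → S (n ∷ xs))}
  ... | yes small = small
  ... | no ¬small = ⊥-elim (¬L large)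
    where
    large : Large (suc j) S
    large m with em {Σ ℕ λ n → m ≤ n × Large j (λ xs → S (n ∷ xs))}
    ... | yes l = l
    ... | no ¬l = ⊥-elim (¬small (m , λ n m≤n L → ¬l (n , m≤n , L)))

  Large-⊎ : ∀ j {S T : Vec ℕ j → Set} → Large j (λ x → S x ⊎ T x) → Large j S ⊎ Large j T
  Large-⊎ zero L = L
  Large-⊎ (suc j) {S} {T} L with em {Large (suc j) S}
  ... | yes LS = inj₁ LS
  ... | no ¬LS = inj₂ LT
    where
    small = ¬Large⇒small-fibres j {S} ¬LS
    m₀ = proj₁ small
    LT : Large (suc j) T
    LT m with L (m ⊔ m₀)
    ... | n , m⊔m₀≤n , L′ with Large-⊎ j {λ xs → S (n ∷ xs)} {λ xs → T (n ∷ xs)} L′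
    ...   | inj₁ LS′ = ⊥-elim (proj₂ small n (≤-trans (m≤n⊔m m m₀) m⊔m₀≤n) LS′)
    ...   | inj₂ LT′ = n , ≤-trans (m≤m⊔n m m₀) m⊔m₀≤n , LT′

  ¬Large⇒Large-∁ : ∀ j {S : Vec ℕ j → Set} → ¬ Large j S → Large j (λ x → ¬ S x)
  ¬Large⇒Large-∁ j ¬L with Large-⊎ j (Large-mono j (λ x _ → toSum em) (Large-⊤ j))
  ... | inj₁ L = ⊥-elim (¬L L)
  ... | inj₂ L∁ = L∁

  ¬Large-Any : ∀ j {I : Set} (S : I → Vec ℕ j → Set) (is : List I) →
    (∀ i → i ∈ is → ¬ Large j (S i)) → ¬ Large j (λ x → Any (λ i → S i x) is)
  ¬Large-Any j S [] _ L with Large⇒nonempty j L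
  ... | _ , ()
  ¬Large-Any j S (i ∷ is) small L
    with Large-⊎ j (Large-mono j (λ { x (here s) → inj₁ s ; x (there s) → inj₂ s }) L)
  ... | inj₁ L₀ = small i (here refl) L₀
  ... | inj₂ L′ = ¬Large-Any j S is (λ i′ i′∈is → small i′ (there i′∈is)) L′

Bounded : (ℕ → Set) → Set
Bounded P = Σ ℕ λ M → ∀ n → P n → n ≤ M

Bounded-Any : {I : Set} (P : I → ℕ → Set) → (∀ i → Bounded (P i)) →
              (is : List I) → Bounded (λ n → Any (λ i → P i n) is)
Bounded-Any P bounded [] = 0 , λ _ ()
Bounded-Any P bounded (i ∷ is) with bounded i | Bounded-Any P bounded is
... | M , ≤M | M′ , ≤M′ = M ⊔ M′ , λ where
  n (here p) → ≤-trans (≤M n p) (m≤m⊔n M M′)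
  n (there p) → ≤-trans (≤M′ n p) (m≤n⊔m M M′)

Bounded⇒escapes : {P : ℕ → Set} → Bounded P → ∀ i → Σ ℕ λ n → i ≤ n × ¬ P n
Bounded⇒escapes (M , ≤M) i =
  suc (i ⊔ M) , m≤n⇒m≤1+n (m≤m⊔n i M) , λ p → <⇒≱ (s≤s (m≤n⊔m i M)) (≤M _ p)

module _ (em : ExcludedMiddle 0ℓ) {X : Set} (β : ℕ → X) (β-injective : ∀ {m n} → β m ≡ β n → m ≡ n) where

  Bounded-preimage : (v : X) → Bounded (λ n → β n ≡ v)
  Bounded-preimage v with em {Σ ℕ λ n → β n ≡ v}
  ... | yes (n₀ , βn₀≡v) = n₀ , λ n βn≡v → ≤-reflexive (β-injective (trans βn≡v (sym βn₀≡v)))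
  ... | no ∄n = 0 , λ n βn≡v → ⊥-elim (∄n (n , βn≡v))

  Finite⇒Bounded-preimage : {S : Subset X} → Finite S → Bounded (λ n → S (β n))
  Finite⇒Bounded-preimage (l , l-covers) =
    let (M , ≤M) = Bounded-Any (λ v n → β n ≡ v) Bounded-preimage l
    in M , λ n s → ≤M n (l-covers (β n) s)

Minimal : {X : Set} → (X → X → Set) → (X → Set) → X → Set
Minimal _<_ P m = P m × (∀ y → y < m → ¬ P y)

minimal : ExcludedMiddle 0ℓ → {X : Set} {_<_ : X → X → Set} → WellFounded _<_ →
          (P : X → Set) → Σ X P → Σ X (Minimal _<_ P)
minimal em {X} {_<_} wf P (x , px) = descend (wf x) px
  where
  descend : ∀ {x} → Acc _<_ x → P x → Σ X (Minimal _<_ P)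
  descend {x} (acc rs) px with em {Σ X λ y → y < x × P y}
  ... | yes (y , y<x , py) = descend (rs y<x) py
  ... | no ∄y = x , px , λ y y<x py → ∄y (y , y<x , py)

minimal-unique : {X : Set} {_<_ : X → X → Set} → Trichotomous _≡_ _<_ →
                 {P Q : X → Set} → (∀ x → P x → Q x) → (∀ x → Q x → P x) →
                 ∀ {m m′} → Minimal _<_ P m → Minimal _<_ Q m′ → m ≡ m′
minimal-unique compare P⊆Q Q⊆P {m} {m′} (pm , m-min) (qm′ , m′-min) with compare m m′
... | tri< m<m′ _ _ = ⊥-elim (m′-min m m<m′ (P⊆Q m pm))
... | tri≈ _ m≡m′ _ = m≡m′
... | tri> _ _ m′<m = ⊥-elim (m-min m′ m′<m (Q⊆P m′ qm′))

-- Transfinite enumeration of S: h x is the least element of S above every h y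
-- with y < x.  The copy g of D inside S keeps h x ≤ g x, so the recursion never
-- runs out, and as S lies in the image of f, h x ≥ f x forces h onto S.
module Enumeration (em : ExcludedMiddle 0ℓ)
  {D W : Set} {_<D_ : D → D → Set} {_<_ : W → W → Set}
  (<D-wellFounded : WellFounded _<D_)
  (<-isStrictTotalOrder : IsStrictTotalOrder _≡_ _<_) (<-wellFounded : WellFounded _<_)
  (S : W → Set)
  (f : D → W) (f-reflects : ∀ x y → f x < f y → x <D y) (S⊆f[D] : ∀ s → S s → Σ D λ x → f x ≡ s)
  (g : D → W) (g-mono : ∀ x y → x <D y → g x < g y) (g∈S : ∀ x → S (g x)) where

  open IsStrictTotalOrder <-isStrictTotalOrder using (compare) renaming (trans to <-trans′)

  ≮-<-trans : ∀ {a b c} → ¬ (b < a) → b < c → a < c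
  ≮-<-trans {a} {b} b≮a b<c with compare a b
  ... | tri< a<b _ _ = <-trans′ a<b b<c
  ... | tri≈ _ refl _ = b<c
  ... | tri> _ _ b<a = ⊥-elim (b≮a b<a)

  Above : (x : D) → WfRec _<D_ (λ _ → W) x → W → Set
  Above x rec s = S s × (∀ {y} (y<x : y <D x) → rec y<x < s)

  Candidate : (x : D) → WfRec _<D_ (λ _ → W) x → W → Set
  Candidate x rec s = Above x rec s ⊎ s ≡ g x

  step : (x : D) → WfRec _<D_ (λ _ → W) x → W
  step x rec = proj₁ (minimal em <-wellFounded (Candidate x rec) (g x , inj₂ refl))

  step-ext : (x : D) {rec rec′ : WfRec _<D_ (λ _ → W) x} →
             (∀ {y} y<x → rec {y} y<x ≡ rec′ y<x) → step x rec ≡ step x rec′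
  step-ext x {rec} {rec′} rec≡rec′ =
    minimal-unique compare (transport rec≡rec′) (transport (λ y<x → sym (rec≡rec′ y<x)))
      (proj₂ (minimal em <-wellFounded (Candidate x rec) _))
      (proj₂ (minimal em <-wellFounded (Candidate x rec′) _))
    where
    transport : ∀ {r r′ : WfRec _<D_ (λ _ → W) x} → (∀ {y} y<x → r {y} y<x ≡ r′ y<x) →
                ∀ s → Candidate x r s → Candidate x r′ s
    transport r≡r′ s (inj₁ (s∈S , r<s)) = inj₁ (s∈S , λ y<x → subst (_< s) (r≡r′ y<x) (r<s y<x))
    transport r≡r′ s (inj₂ s≡gx) = inj₂ s≡gx

  h : D → W
  h = All.wfRec <D-wellFounded 0ℓ (λ _ → W) step

  h-minimal : ∀ x → Minimal _<_ (Candidate x (λ {y} _ → h y)) (h x)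
  h-minimal x = subst (Minimal _<_ (Candidate x (λ {y} _ → h y)))
    (sym (FixPoint.unfold-wfRec <D-wellFounded (λ _ → W) step step-ext))
    (proj₂ (minimal em <-wellFounded (Candidate x (λ {y} _ → h y)) (g x , inj₂ refl)))

  h<g : ∀ {y x} → y <D x → h y < g x
  h<g {y} {x} y<x = ≮-<-trans (λ gy<hy → proj₂ (h-minimal y) (g y) gy<hy (inj₂ refl)) (g-mono y x y<x)

  h∈Above : ∀ x → Above x (λ {y} _ → h y) (h x)
  h∈Above x with proj₁ (h-minimal x)
  ... | inj₁ above = above
  ... | inj₂ hx≡gx = subst (Above x (λ {y} _ → h y)) (sym hx≡gx) (g∈S x , h<g)

  h-mono : ∀ x y → x <D y → h x < h y
  h-mono x y x<y = proj₂ (h∈Above y) x<y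

  h∈S : ∀ x → S (h x)
  h∈S x = proj₁ (h∈Above x)

  h≮f : ∀ x → ¬ (h x < f x)
  h≮f x = go (<D-wellFounded x)
    where
    go : ∀ {x} → Acc _<D_ x → ¬ (h x < f x)
    go {x} (acc rs) hx<fx with S⊆f[D] (h x) (h∈S x)
    ... | v , fv≡hx =
      let v<x = f-reflects v x (subst (_< f x) (sym fv≡hx) hx<fx)
      in go (rs v<x) (subst (h v <_) (sym fv≡hx) (h-mono v x v<x))

  h-onto : ∀ s → S s → Σ D λ x → h x ≡ s
  h-onto s s∈S with S⊆f[D] s s∈S
  ... | x₀ , fx₀≡s with minimal em <D-wellFounded (λ w → ¬ (h w < s)) (x₀ , subst (λ t → ¬ (h x₀ < t)) fx₀≡s (h≮f x₀))
  ... | w , hw≮s , w-min with compare (h w) s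
  ...   | tri< hw<s _ _ = ⊥-elim (hw≮s hw<s)
  ...   | tri≈ _ hw≡s _ = w , hw≡s
  ...   | tri> _ _ s<hw = ⊥-elim (proj₂ (h-minimal w) s s<hw (inj₁ (s∈S , below)))
    where
    below : ∀ {y} → y <D w → h y < s
    below {y} y<w with compare (h y) s
    ... | tri< hy<s _ _ = hy<s
    ... | tri≈ hy≮s _ _ = ⊥-elim (w-min y y<w hy≮s)
    ... | tri> hy≮s _ _ = ⊥-elim (w-min y y<w hy≮s)

  enumeration : Σ (D → W) λ h → (∀ x y → x <D y → h x < h y) × (∀ x → S (h x)) × (∀ s → S s → Σ D λ x → h x ≡ s)
  enumeration = h , h-mono , h∈S , h-onto

module _ (em : ExcludedMiddle 0ℓ) (δ : Ordinal) (G : Graph (Ordinal.Carrier δ))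
  (j : ℕ) (A B : Subset (Ordinal.Carrier δ))
  (A≅ωᵏ : OrdinalNotions.OtpOmegaPow δ (suc j) A)
  (B≅ω : OrdinalNotions.OtpOmegaPow δ 1 B)
  (A⟹B : OrdinalNotions._⟹_ δ G A B) where

  open Ordinal δ using (Carrier; isStrictTotalOrder; wellFounded) renaming (_<_ to _≺_)
  open IsStrictTotalOrder isStrictTotalOrder using (irrefl) renaming (trans to ≺-trans)
  open Graph G using (E)
  open GraphNotions G
  open OrdinalNotions δ using (Cofinal; OtpOmegaPow)

  α : Vec ℕ (suc j) → Carrier
  α = proj₁ A≅ωᵏ

  α-mono : ∀ x y → x <lex y → α x ≺ α y
  α-mono = proj₁ (proj₂ A≅ωᵏ)

  α∈A : ∀ x → A (α x)
  α∈A = proj₁ (proj₂ (proj₂ A≅ωᵏ))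

  α-onto : ∀ a → A a → Σ (Vec ℕ (suc j)) λ x → α x ≡ a
  α-onto = proj₂ (proj₂ (proj₂ A≅ωᵏ))

  α-reflects : ∀ x y → α x ≺ α y → x <lex y
  α-reflects x y αx≺αy with <lex-trichotomy x y
  ... | inj₁ x<y = x<y
  ... | inj₂ (inj₁ refl) = ⊥-elim (irrefl refl αx≺αy)
  ... | inj₂ (inj₂ y<x) = ⊥-elim (irrefl refl (≺-trans αx≺αy (α-mono y x y<x)))

  <lex-wellFounded : WellFounded (_<lex_ {suc j})
  <lex-wellFounded = Subrelation.wellFounded (α-mono _ _) (On.wellFounded α wellFounded)

  β : ℕ → Carrier
  β n = proj₁ B≅ω (n ∷ [])

  β∈B : ∀ n → B (β n)
  β∈B n = proj₁ (proj₂ (proj₂ B≅ω)) (n ∷ [])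

  β-injective : ∀ {m n} → β m ≡ β n → m ≡ n
  β-injective {m} {n} βm≡βn with <-cmp m n
  ... | tri< m<n _ _ = ⊥-elim (irrefl βm≡βn (proj₁ (proj₂ B≅ω) _ _ (here m<n)))
  ... | tri≈ _ m≡n _ = m≡n
  ... | tri> _ _ n<m = ⊥-elim (irrefl (sym βm≡βn) (proj₁ (proj₂ B≅ω) _ _ (here n<m)))

  Bounded-neighbours : ∀ x → Bounded (λ n → E (α x) (β n))
  Bounded-neighbours x with Finite⇒Bounded-preimage em β β-injective (proj₂ A⟹B (α x) (α∈A x))
  ... | M , ≤M = M , λ n e → ≤M n (e , β∈B n)

  module AllNeighbourhoodsSmall (small : ∀ n → ¬ Large (suc j) (λ x → E (β n) (α x))) where

    fresh-β : ∀ i (xs : List (Vec ℕ (suc j))) → Σ ℕ λ n → i ≤ n × ¬ Any (λ x → E (α x) (β n)) xs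
    fresh-β i xs = Bounded⇒escapes (Bounded-Any (λ x n → E (α x) (β n)) Bounded-neighbours xs) i

    fresh-α : ∀ i (ns : List ℕ) → Σ (Vec ℕ (suc j)) λ x → i ≤ head x × ¬ Any (λ n → E (β n) (α x)) ns
    fresh-α i ns = Large⇒unbounded j
      (¬Large⇒Large-∁ em (suc j) {λ x → Any (λ n → E (β n) (α x)) ns}
        (¬Large-Any em (suc j) (λ n x → E (β n) (α x)) ns (λ n _ → small n))) i

    Stage : Set
    Stage = ℕ × Vec ℕ (suc j)

    next : ℕ → List Stage → Stage
    next i l = let n = proj₁ (fresh-β i (map proj₂ l)) in n , proj₁ (fresh-α i (n ∷ map proj₁ l))

    history : ℕ → List Stage
    history zero = []
    history (suc i) = next i (history i) ∷ history i

    stage : ℕ → Stage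
    stage i = next i (history i)

    Separated : List Stage → Set
    Separated l = ∀ p q → p ∈ l → q ∈ l → ¬ E (α (proj₂ q)) (β (proj₁ p))

    separated : ∀ i → Separated (history i)
    separated zero _ _ ()
    separated (suc i) = sep
      where
      l = history i
      βᵢ = fresh-β i (map proj₂ l)
      αᵢ = fresh-α i (proj₁ βᵢ ∷ map proj₁ l)
      sep : Separated (history (suc i))
      sep _ _ (here refl) (here refl) e = proj₂ (proj₂ αᵢ) (here (Graph.sym G e))
      sep _ q (here refl) (there q∈l) e = proj₂ (proj₂ βᵢ) (lose (∈-map⁺ proj₂ q∈l) e)
      sep p _ (there p∈l) (here refl) e = proj₂ (proj₂ αᵢ) (there (lose (∈-map⁺ proj₁ p∈l) (Graph.sym G e)))
      sep p q (there p∈l) (there q∈l) = separated i p q p∈l q∈l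

    stage∈history : ∀ {i i′} → i < i′ → stage i ∈ history i′
    stage∈history {i} {suc i′} (s≤s i≤i′) with m≤n⇒m<n∨m≡n i≤i′
    ... | inj₁ i<i′ = there (stage∈history i<i′)
    ... | inj₂ refl = here refl

    no-edge : ∀ i i′ → ¬ E (α (proj₂ (stage i′))) (β (proj₁ (stage i)))
    no-edge i i′ = separated (suc (i ⊔ i′)) (stage i) (stage i′)
      (stage∈history (s≤s (m≤m⊔n i i′))) (stage∈history (s≤s (m≤n⊔m i i′)))

    β-index-large : ∀ i → i ≤ proj₁ (stage i)
    β-index-large i = proj₁ (proj₂ (fresh-β i (map proj₂ (history i))))

    α-index-large : ∀ i → i ≤ head (proj₂ (stage i))
    α-index-large i = proj₁ (proj₂ (fresh-α i (proj₁ (stage i) ∷ map proj₁ (history i))))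

    X : Subset Carrier
    X v = Σ ℕ λ i → α (proj₂ (stage i)) ≡ v

    X-cofinal : Cofinal A X
    X-cofinal = (λ { _ (i , refl) → α∈A _ }) , above
      where
      above : ∀ a → A a → Σ Carrier λ v → X v × OrdinalNotions._≤_ δ a v
      above a a∈A with α-onto a a∈A
      ... | c ∷ ys , refl =
        α (proj₂ (stage (suc c))) , (suc c , refl) , inj₂ (α-mono _ _ (<head⇒<lex _ (α-index-large (suc c))))

    contradiction : ⊥
    contradiction with Finite⇒Bounded-preimage em β β-injective (proj₁ A⟹B X X-cofinal)
    ... | M , ≤M = <⇒≱ (β-index-large (suc M)) (≤M _ (β∈B _ , missed))
      where
      missed : ¬ N[ X ] (β (proj₁ (stage (suc M))))
      missed (_ , (i , refl) , e) = no-edge (suc M) i e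

  large-neighbourhood : Σ Carrier λ b → B b × OtpOmegaPow (suc j) (N b ∩ A)
  large-neighbourhood with em {Σ ℕ λ n → Large (suc j) (λ x → E (β n) (α x))}
  ... | no ∄n = ⊥-elim (AllNeighbourhoodsSmall.contradiction (λ n L → ∄n (n , L)))
  ... | yes (n , L) with Large⇒embedding (suc j) {λ x → E (β n) (α x)} L
  ...   | e , e-mono , e∈N = β n , β∈B n ,
    Enumeration.enumeration em <lex-wellFounded isStrictTotalOrder wellFounded
      (N (β n) ∩ A) α α-reflects (λ v (_ , v∈A) → α-onto v v∈A)
      (λ x → α (e x)) (λ x y x<y → α-mono _ _ (e-mono x y x<y)) (λ x → e∈N x , α∈A (e x))

mainTheorem4 : ExcludedMiddle 0ℓ →
    (δ : Ordinal) → (G : Graph (Ordinal.Carrier δ)) →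
    GraphNotions.TriangleFree G →
    (k : ℕ) → k ≥ 1 →
    (A B : Subset (Ordinal.Carrier δ)) →
    OrdinalNotions.OtpOmegaPow δ k A →
    OrdinalNotions.OtpOmegaPow δ 1 B →
    Disjoint A B →
    OrdinalNotions._⟹_ δ G A B →
    Σ (Ordinal.Carrier δ) λ b → B b ×
      OrdinalNotions.OtpOmegaPow δ k (GraphNotions.N G b ∩ A)
mainTheorem4 em δ G _ (suc j) _ A B A≅ωᵏ B≅ω _ A⟹B = large-neighbourhood em δ G j A B A≅ωᵏ B≅ω A⟹B
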